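{- Let $\Sigma$ be an action signature. For every simple action $\alpha$ of $\mathcal L_1(\Sigma)$, every agent $A$ and every sentence $\varphi$ of $\mathcal L_1(\Sigma)$, the Action-Knowledge Axiom holds in the generalized form $$\vdash[\alpha]\Box_A\varphi\leftrightarrow\Big(\mathrm{Pre}(\alpha)\to\bigwedge\{\Box_A[\beta]\varphi:\alpha\to_A\beta\text{ in }\Omega\}\Big),$$ where $\vdash$ is derivability in the logical system for $\mathcal L_1(\Sigma)$ (an empty conjunction is $\mathsf{true}$).
   Context: Fix AtSen and Agents. An action signature $\Sigma$: a finite set with relations $\to_A$ and an enumeration $\sigma_1,\dots,\sigma_n$. $\mathcal L_1(\Sigma)$: sentences $\mathsf{true}\mid p\mid\neg\varphi\mid\varphi\wedge\psi\mid\Box_A\varphi\mid\Box^*_B\varphi\mid[\pi]\varphi$ ($B\subseteq$ Agents); programs $\mathsf{skip}\mid\mathsf{crash}\mid\sigma_i\psi_1\cdots\psi_n\mid\pi\cup\rho\mid\pi;\rho$. $\langle\pi\rangle=\neg[\pi]\neg$. Simple actions are programs without $\cup$. $\Omega$: simple actions with the smallest relations $\to_A$ such that $\mathsf{skip}\to_A\mathsf{skip}$, $\sigma_i\vec\varphi\to_A\sigma_j\vec\psi$ iff $\sigma_i\to_A\sigma_j$ in $\Sigma$ and $\vec\varphi=\vec\psi$, and $\alpha;\beta\to_A\alpha';\beta'$ whenever $\alpha\to_A\alpha'$, $\beta\to_A\beta'$; $\to^*_C$ denotes the reflexive-transitive closure of $\bigcup_{A\in C}\to_A$. $\mathrm{Pre}(\mathsf{skip})=\mathsf{true}$,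 $\mathrm{Pre}(\mathsf{crash})=\mathsf{false}$, $\mathrm{Pre}(\sigma_i\vec\psi)=\psi_i$, $\mathrm{Pre}(\alpha;\beta)=\langle\alpha\rangle\mathrm{Pre}(\beta)$. Logical system for $\mathcal L_1(\Sigma)$: axioms: propositional tautologies; $K$-normality for $[\pi]$, $\Box_A$, $\Box^*_C$; Atomic Permanence $[\sigma_i\vec\psi]p\leftrightarrow(\psi_i\to p)$; Partial Functionality $[\sigma_i\vec\psi]\neg\chi\leftrightarrow(\psi_i\to\neg[\sigma_i\vec\psi]\chi)$; Action-Knowledge $[\sigma_i\vec\psi]\Box_A\varphi\leftrightarrow(\psi_i\to\bigwedge\{\Box_A[\sigma_j\vec\psi]\varphi:\sigma_i\to_A\sigma_j\text{ in }\Sigma\})$; Epistemic Mix $\Box^*_C\varphi\to\varphi\wedge\bigwedge_{A\in C}\Box_A\Box^*_C\varphi$; Skip $[\mathsf{skip}]\varphi\leftrightarrow\varphi$; Crash $[\mathsf{crash}]\mathsf{false}$; Composition $[\pi][\rho]\varphi\leftrightarrow[\pi;\rho]\varphi$; Choice $[\pi\cup\rho]\varphi\leftrightarrow[\pi]\varphi\wedge[\rho]\varphi$. Rules: modus ponens; necessitation for $[\pi]$, $\Box_A$, $\Box^*_C$; Action Rule: for simple $\alpha$, sentence $\psi$, $C\subseteq$ Agents, and sentences $\chi_\beta$ for all $\beta$ with $\alpha\to^*_C\beta$: from $\vdash\chi_\beta\to[\beta]\psi$ (all such $\beta$) and $\vdash(\chi_\beta\wedge\mathrm{Pre}(\beta))\to\Box_A\chi_\gamma$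 (all $A\in C$, $\beta\to_A\gamma$) infer $\vdash\chi_\alpha\to[\alpha]\Box^*_C\psi$. -}

module Defs where

open import Data.Nat using (ℕ)
open import Data.Fin using (Fin)
open import Data.Bool using (Bool; true; false; not; T) renaming (_∧_ to _&&_)
open import Data.List using (List; []; _∷_; map; filterᵇ; allFin)
open import Data.List.Membership.Propositional using (_∈_)
open import Data.Vec using (Vec; lookup)
open import Data.Product using (Σ; _×_; ∃)
open import Relation.Binary.Construct.Closure.ReflexiveTransitive using (Star)

-- An action signature: a finite set of action types, enumerated as
-- σ_1 … σ_n (represented by Fin n), with a (decidable) relation →_A for
-- every agent A.
record Signature (Agents : Set) : Set₁ where
  field
    size  : ℕ
    arrow : Agents → Fin size → Fin size → Bool

module L1 (AtSen Agents : Set) (Sig : Signature Agents) where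
  open Signature Sig renaming (size to n)

  infixr 6 _∧ₛ_
  infixr 5 _⇒_
  infix 4 _⇔ₛ_

  mutual
    data Sentence : Set where
      ⊤ₛ    : Sentence
      atom  : AtSen → Sentence
      ¬ₛ    : Sentence → Sentence
      _∧ₛ_  : Sentence → Sentence → Sentence
      □     : Agents → Sentence → Sentence
      □*    : List Agents → Sentence → Sentence       -- □*_B φ  (B a finite set of agents, given as a list)
      [_]_  : Program → Sentence → Sentence

    data Program : Set where
      skip  : Program
      crash : Program
      act   : Fin n → Vec Sentence n → Program        -- σ_i ψ_1 ⋯ ψ_n
      _∪_   : Program → Program → Program
      _⨾_   : Program → Program → Program

  ⊥ₛ : Sentence
  ⊥ₛ = ¬ₛ ⊤ₛ

  _⇒_ : Sentence → Sentence → Sentence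
  φ ⇒ ψ = ¬ₛ (φ ∧ₛ ¬ₛ ψ)

  _⇔ₛ_ : Sentence → Sentence → Sentence
  φ ⇔ₛ ψ = (φ ⇒ ψ) ∧ₛ (ψ ⇒ φ)

  ⟨_⟩_ : Program → Sentence → Sentence
  ⟨ π ⟩ φ = ¬ₛ ([ π ] ¬ₛ φ)

  ⋀ : List Sentence → Sentence
  ⋀ []       = ⊤ₛ
  ⋀ (φ ∷ φs) = φ ∧ₛ ⋀ φs

  data IsSimple : Program → Set where
    skip  : IsSimple skip
    crash : IsSimple crash
    act   : ∀ i ψs → IsSimple (act i ψs)
    seq   : ∀ {α β} → IsSimple α → IsSimple β → IsSimple (α ⨾ β)

  data _⟶[_]_ : Program → Agents → Program → Set where
    skip→ : ∀ {A} → skip ⟶[ A ] skip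
    act→  : ∀ {A i j ψs} → T (arrow A i j) → act i ψs ⟶[ A ] act j ψs
    seq→  : ∀ {A α α' β β'} → α ⟶[ A ] α' → β ⟶[ A ] β' → (α ⨾ β) ⟶[ A ] (α' ⨾ β')

  _⟶*[_]_ : Program → List Agents → Program → Set
  α ⟶*[ C ] β = Star (λ x y → ∃ λ A → A ∈ C × x ⟶[ A ] y) α β

  -- preconditions (only meaningful for simple actions; the ∪ clause is unused)
  Pre : Program → Sentence
  Pre skip       = ⊤ₛ
  Pre crash      = ⊥ₛ
  Pre (act i ψs) = lookup ψs i
  Pre (α ⨾ β)    = ⟨ α ⟩ Pre β
  Pre (α ∪ β)    = ⊤ₛ

  -- propositional tautologies: true under every Boolean valuation of the
  -- non-propositional (atomic, modal, dynamic) subformulas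
  eval : (Sentence → Bool) → Sentence → Bool
  eval v ⊤ₛ         = true
  eval v (¬ₛ φ)     = not (eval v φ)
  eval v (φ ∧ₛ ψ)   = eval v φ && eval v ψ
  eval v (atom p)   = v (atom p)
  eval v (□ A φ)    = v (□ A φ)
  eval v (□* B φ)   = v (□* B φ)
  eval v ([ π ] φ)  = v ([ π ] φ)

  Tautology : Sentence → Set
  Tautology φ = (v : Sentence → Bool) → T (eval v φ)

  actKnowConj : Agents → Fin n → Vec Sentence n → Sentence → Sentence
  actKnowConj A i ψs φ = ⋀ (map (λ j → □ A ([ act j ψs ] φ)) (filterᵇ (arrow A i) (allFin n)))

  infix 2 ⊢_
  data ⊢_ : Sentence → Set where
    taut        : ∀ {φ} → Tautology φ → ⊢ φ
    K-prog      : ∀ π φ ψ → ⊢ [ π ] (φ ⇒ ψ) ⇒ ([ π ] φ ⇒ [ π ] ψ)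
    K-box       : ∀ A φ ψ → ⊢ □ A (φ ⇒ ψ) ⇒ (□ A φ ⇒ □ A ψ)
    K-box*      : ∀ C φ ψ → ⊢ □* C (φ ⇒ ψ) ⇒ (□* C φ ⇒ □* C ψ)
    atomicPerm  : ∀ i ψs p → ⊢ [ act i ψs ] atom p ⇔ₛ (lookup ψs i ⇒ atom p)
    partialFun  : ∀ i ψs χ → ⊢ [ act i ψs ] ¬ₛ χ ⇔ₛ (lookup ψs i ⇒ ¬ₛ ([ act i ψs ] χ))
    actionKnow  : ∀ i ψs A φ → ⊢ [ act i ψs ] □ A φ ⇔ₛ (lookup ψs i ⇒ actKnowConj A i ψs φ)
    epistMix    : ∀ C φ → ⊢ □* C φ ⇒ (φ ∧ₛ ⋀ (map (λ A → □ A (□* C φ)) C))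
    skipAx      : ∀ φ → ⊢ [ skip ] φ ⇔ₛ φ
    crashAx     : ⊢ [ crash ] ⊥ₛ
    composition : ∀ π ρ φ → ⊢ [ π ] [ ρ ] φ ⇔ₛ [ π ⨾ ρ ] φ
    choice      : ∀ π ρ φ → ⊢ [ π ∪ ρ ] φ ⇔ₛ ([ π ] φ ∧ₛ [ ρ ] φ)
    mp          : ∀ {φ ψ} → ⊢ φ ⇒ ψ → ⊢ φ → ⊢ ψ
    nec-prog    : ∀ π {φ} → ⊢ φ → ⊢ [ π ] φ
    nec-box     : ∀ A {φ} → ⊢ φ → ⊢ □ A φ
    nec-box*    : ∀ C {φ} → ⊢ φ → ⊢ □* C φ
    actionRule  : ∀ {α} → IsSimple α → ∀ ψ C (χ : Program → Sentence)
                → (∀ β → α ⟶*[ C ] β → ⊢ χ β ⇒ [ β ] ψ)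
                → (∀ β γ A → α ⟶*[ C ] β → A ∈ C → β ⟶[ A ] γ
                     → ⊢ (χ β ∧ₛ Pre β) ⇒ □ A (χ γ))
                → ⊢ χ α ⇒ [ α ] □* C ψ

-- The Action-Knowledge axiom covers only basic actions σᵢψ⃗; it extends to all simple actions
-- by induction, the only real case being α ; β. Composition turns [α ; β]□_A φ into
-- [α][β]□_A φ, the induction hypothesis for β moves □_A inside [β], and [α] is then pushed
-- through the resulting implication and conjunction, where the hypothesis for α applies. Pushing
-- [α] through an implication needs partial functionality, extended to simple α by the same
-- induction: [α](P ⇒ Q) ⇔ (⟨α⟩P ⇒ [α]Q), and since ⟨α⟩P ⇒ Pre α the precondition of α is
-- absorbed into Pre (α ; β) = ⟨α⟩ Pre β.
module Submission where

open import Defs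
open import Data.List using (List; map)
open import Data.List.Membership.Propositional using (_∈_)
open import Function.Bundles using (_⇔_)

open import Data.Bool using (Bool; true; false; T; T?; not) renaming (_∧_ to _&&_)
open import Data.Bool.Properties using (T-∧)
open import Data.Fin using (Fin; #_)
open import Data.List using ([]; _∷_; filterᵇ; allFin; cartesianProductWith)
open import Data.List.Membership.Propositional.Properties
  using (∈-allFin; ∈-map∘filter⁺; ∈-map∘filter⁻; ∈-cartesianProductWith⁺; ∈-cartesianProductWith⁻)
open import Data.List.Properties using (map-∘)
open import Data.List.Relation.Binary.Subset.Propositional using (_⊆_)
open import Data.List.Relation.Unary.Any using (here; there)
open import Data.Nat using (ℕ; zero; suc; _<?_)
open import Data.Product using (_,_; proj₁; proj₂)
open import Data.Vec using (Vec; []; _∷_; lookup)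
import Data.Vec as Vec
open import Data.Vec.Properties using (lookup-map)
open import Function using (_∘_)
open import Function.Bundles using (Equivalence)
open import Level using (0ℓ)
open import Relation.Binary.Bundles using (Setoid)
open import Relation.Binary.PropositionalEquality using (_≡_; refl; sym; cong; cong₂; subst)
import Relation.Binary.Reasoning.Setoid as SetoidReasoning
open import Relation.Nullary.Decidable using (True)

data Schema (k : ℕ) : Set where
  var   : Fin k → Schema k
  ‵⊤    : Schema k
  ‵¬    : Schema k → Schema k
  _‵∧_  : Schema k → Schema k → Schema k

infixr 6 _‵∧_
infixr 5 _‵⇒_
infix 4 _‵⇔_

_‵⇒_ : ∀ {k} → Schema k → Schema k → Schema k
a ‵⇒ b = ‵¬ (a ‵∧ ‵¬ b)

_‵⇔_ : ∀ {k} → Schema k → Schema k → Schema k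
a ‵⇔ b = (a ‵⇒ b) ‵∧ (b ‵⇒ a)

‵_ : ∀ {k} (m : ℕ) {m<k : True (m <? k)} → Schema k
‵_ m {m<k} = var ((# m) {m<n = m<k})

⟦_⟧ : ∀ {k} → Schema k → Vec Bool k → Bool
⟦ var i ⟧  bs = lookup bs i
⟦ ‵⊤ ⟧     bs = true
⟦ ‵¬ a ⟧   bs = not (⟦ a ⟧ bs)
⟦ a ‵∧ b ⟧ bs = ⟦ a ⟧ bs && ⟦ b ⟧ bs

holdsEverywhere : ∀ k → (Vec Bool k → Bool) → Bool
holdsEverywhere zero    g = g []
holdsEverywhere (suc k) g = holdsEverywhere k (g ∘ (true ∷_)) && holdsEverywhere k (g ∘ (false ∷_))

holdsEverywhere-sound : ∀ k (g : Vec Bool k → Bool) → T (holdsEverywhere k g) → ∀ bs → T (g bs)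
holdsEverywhere-sound zero    g h [] = h
holdsEverywhere-sound (suc k) g h (true ∷ bs) =
  holdsEverywhere-sound k _ (proj₁ (Equivalence.to T-∧ h)) bs
holdsEverywhere-sound (suc k) g h (false ∷ bs) =
  holdsEverywhere-sound k _ (proj₂ (Equivalence.to T-∧ h)) bs

Valid : ∀ {k} → Schema k → Set
Valid {k} a = T (holdsEverywhere k ⟦ a ⟧)

module Derivations (AtSen Agents : Set) (Sig : Signature Agents) where
  open L1 AtSen Agents Sig
  open Signature Sig renaming (size to n)

  instantiate : ∀ {k} → Schema k → Vec Sentence k → Sentence
  instantiate (var i)  ps = lookup ps i
  instantiate ‵⊤       ps = ⊤ₛ
  instantiate (‵¬ a)   ps = ¬ₛ (instantiate a ps)
  instantiate (a ‵∧ b) ps = instantiate a ps ∧ₛ instantiate b ps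

  eval-instantiate : ∀ {k} v (a : Schema k) ps → eval v (instantiate a ps) ≡ ⟦ a ⟧ (Vec.map (eval v) ps)
  eval-instantiate v (var i)  ps = sym (lookup-map i (eval v) ps)
  eval-instantiate v ‵⊤       ps = refl
  eval-instantiate v (‵¬ a)   ps = cong not (eval-instantiate v a ps)
  eval-instantiate v (a ‵∧ b) ps = cong₂ _&&_ (eval-instantiate v a ps) (eval-instantiate v b ps)

  -- Validity is decided by computing the truth table during type checking, so a schema that
  -- is not a tautology shows up as an unsolved implicit argument.
  tautology : ∀ {k} (a : Schema k) (ps : Vec Sentence k) {_ : Valid a} → ⊢ instantiate a ps
  tautology {k} a ps {valid} = taut λ v →
    subst T (sym (eval-instantiate v a ps))
      (holdsEverywhere-sound k ⟦ a ⟧ valid (Vec.map (eval v) ps))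

  ⇔-refl : ∀ {a} → ⊢ a ⇔ₛ a
  ⇔-refl {a} = tautology (‵ 0 ‵⇔ ‵ 0) (a ∷ [])

  ⇔-sym : ∀ {a b} → ⊢ a ⇔ₛ b → ⊢ b ⇔ₛ a
  ⇔-sym {a} {b} = mp (tautology ((‵ 0 ‵⇔ ‵ 1) ‵⇒ (‵ 1 ‵⇔ ‵ 0)) (a ∷ b ∷ []))

  ⇔-trans : ∀ {a b c} → ⊢ a ⇔ₛ b → ⊢ b ⇔ₛ c → ⊢ a ⇔ₛ c
  ⇔-trans {a} {b} {c} a⇔b = mp (mp (tautology ((‵ 0 ‵⇔ ‵ 1) ‵⇒ (‵ 1 ‵⇔ ‵ 2) ‵⇒ (‵ 0 ‵⇔ ‵ 2)) (a ∷ b ∷ c ∷ [])) a⇔b)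

  ⇔-setoid : Setoid 0ℓ 0ℓ
  ⇔-setoid = record
    { Carrier       = Sentence
    ; _≈_           = λ a b → ⊢ a ⇔ₛ b
    ; isEquivalence = record { refl = ⇔-refl ; sym = ⇔-sym ; trans = ⇔-trans }
    }

  open SetoidReasoning ⇔-setoid

  ⇔⇒⇒ : ∀ {a b} → ⊢ a ⇔ₛ b → ⊢ a ⇒ b
  ⇔⇒⇒ {a} {b} = mp (tautology ((‵ 0 ‵⇔ ‵ 1) ‵⇒ (‵ 0 ‵⇒ ‵ 1)) (a ∷ b ∷ []))

  ⇔⇒⇐ : ∀ {a b} → ⊢ a ⇔ₛ b → ⊢ b ⇒ a
  ⇔⇒⇐ {a} {b} = mp (tautology ((‵ 0 ‵⇔ ‵ 1) ‵⇒ (‵ 1 ‵⇒ ‵ 0)) (a ∷ b ∷ []))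

  ⇒⇐⇒⇔ : ∀ {a b} → ⊢ a ⇒ b → ⊢ b ⇒ a → ⊢ a ⇔ₛ b
  ⇒⇐⇒⇔ {a} {b} a⇒b = mp (mp (tautology ((‵ 0 ‵⇒ ‵ 1) ‵⇒ (‵ 1 ‵⇒ ‵ 0) ‵⇒ (‵ 0 ‵⇔ ‵ 1)) (a ∷ b ∷ [])) a⇒b)

  ⇒-trans : ∀ {a b c} → ⊢ a ⇒ b → ⊢ b ⇒ c → ⊢ a ⇒ c
  ⇒-trans {a} {b} {c} a⇒b = mp (mp (tautology ((‵ 0 ‵⇒ ‵ 1) ‵⇒ (‵ 1 ‵⇒ ‵ 2) ‵⇒ (‵ 0 ‵⇒ ‵ 2)) (a ∷ b ∷ c ∷ [])) a⇒b)

  ¬-cong : ∀ {a b} → ⊢ a ⇔ₛ b → ⊢ ¬ₛ a ⇔ₛ ¬ₛ b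
  ¬-cong {a} {b} = mp (tautology ((‵ 0 ‵⇔ ‵ 1) ‵⇒ (‵¬ (‵ 0) ‵⇔ ‵¬ (‵ 1))) (a ∷ b ∷ []))

  ∧-cong : ∀ {a b c d} → ⊢ a ⇔ₛ b → ⊢ c ⇔ₛ d → ⊢ a ∧ₛ c ⇔ₛ b ∧ₛ d
  ∧-cong {a} {b} {c} {d} a⇔b =
    mp (mp (tautology ((‵ 0 ‵⇔ ‵ 1) ‵⇒ (‵ 2 ‵⇔ ‵ 3) ‵⇒ (‵ 0 ‵∧ ‵ 2 ‵⇔ ‵ 1 ‵∧ ‵ 3)) (a ∷ b ∷ c ∷ d ∷ [])) a⇔b)

  ⇒-congˡ : ∀ {a b c} → ⊢ a ⇔ₛ b → ⊢ (a ⇒ c) ⇔ₛ (b ⇒ c)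
  ⇒-congˡ a⇔b = ¬-cong (∧-cong a⇔b ⇔-refl)

  ⇒-congʳ : ∀ {a b c} → ⊢ b ⇔ₛ c → ⊢ (a ⇒ b) ⇔ₛ (a ⇒ c)
  ⇒-congʳ b⇔c = ¬-cong (∧-cong ⇔-refl (¬-cong b⇔c))

  ⇒-absorb : ∀ {a b c} → ⊢ a ⇒ b → ⊢ (a ⇒ (b ⇒ c)) ⇔ₛ (a ⇒ c)
  ⇒-absorb {a} {b} {c} = mp (tautology ((‵ 0 ‵⇒ ‵ 1) ‵⇒ ((‵ 0 ‵⇒ (‵ 1 ‵⇒ ‵ 2)) ‵⇔ (‵ 0 ‵⇒ ‵ 2))) (a ∷ b ∷ c ∷ []))

  ⇒-∧ : ∀ {a b c} → ⊢ c ⇒ a → ⊢ c ⇒ b → ⊢ c ⇒ a ∧ₛ b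
  ⇒-∧ {a} {b} {c} c⇒a = mp (mp (tautology ((‵ 0 ‵⇒ ‵ 1) ‵⇒ (‵ 0 ‵⇒ ‵ 2) ‵⇒ (‵ 0 ‵⇒ ‵ 1 ‵∧ ‵ 2)) (c ∷ a ∷ b ∷ [])) c⇒a)

  ⇒-uncurry : ∀ {a b c} → ⊢ a ⇒ (b ⇒ c) → ⊢ a ∧ₛ b ⇒ c
  ⇒-uncurry {a} {b} {c} = mp (tautology ((‵ 0 ‵⇒ (‵ 1 ‵⇒ ‵ 2)) ‵⇒ (‵ 0 ‵∧ ‵ 1 ‵⇒ ‵ 2)) (a ∷ b ∷ c ∷ []))

  ⋀-map-elim : ∀ {X : Set} (f : X → Sentence) {x xs} → x ∈ xs → ⊢ ⋀ (map f xs) ⇒ f x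
  ⋀-map-elim f {xs = x ∷ xs} (here refl) = tautology (‵ 0 ‵∧ ‵ 1 ‵⇒ ‵ 0) (f x ∷ ⋀ (map f xs) ∷ [])
  ⋀-map-elim f {xs = y ∷ xs} (there x∈xs) =
    ⇒-trans (tautology (‵ 0 ‵∧ ‵ 1 ‵⇒ ‵ 1) (f y ∷ ⋀ (map f xs) ∷ [])) (⋀-map-elim f x∈xs)

  ⋀-map-intro : ∀ {X : Set} {c} (f : X → Sentence) xs → (∀ {x} → x ∈ xs → ⊢ c ⇒ f x) → ⊢ c ⇒ ⋀ (map f xs)
  ⋀-map-intro {c = c} f []       _ = tautology (‵ 0 ‵⇒ ‵⊤) (c ∷ [])
  ⋀-map-intro         f (x ∷ xs) h = ⇒-∧ (h (here refl)) (⋀-map-intro f xs (h ∘ there))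

  ⋀-map-antitone : ∀ {X : Set} (f : X → Sentence) {xs ys} → xs ⊆ ys → ⊢ ⋀ (map f ys) ⇒ ⋀ (map f xs)
  ⋀-map-antitone f {xs} xs⊆ys = ⋀-map-intro f xs (⋀-map-elim f ∘ xs⊆ys)

  ⋀-map-cong : ∀ {X : Set} {f g : X → Sentence} → (∀ x → ⊢ f x ⇔ₛ g x) → ∀ xs → ⊢ ⋀ (map f xs) ⇔ₛ ⋀ (map g xs)
  ⋀-map-cong f⇔g []       = ⇔-refl
  ⋀-map-cong f⇔g (x ∷ xs) = ∧-cong (f⇔g x) (⋀-map-cong f⇔g xs)

  ⋀-map-⇒ : ∀ {X : Set} a (f : X → Sentence) xs → ⊢ ⋀ (map (λ x → a ⇒ f x) xs) ⇔ₛ (a ⇒ ⋀ (map f xs))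
  ⋀-map-⇒ a f []       = tautology (‵⊤ ‵⇔ (‵ 0 ‵⇒ ‵⊤)) (a ∷ [])
  ⋀-map-⇒ a f (x ∷ xs) =
    mp (tautology ((‵ 0 ‵⇔ (‵ 1 ‵⇒ ‵ 2)) ‵⇒ ((‵ 1 ‵⇒ ‵ 3) ‵∧ ‵ 0 ‵⇔ (‵ 1 ‵⇒ ‵ 3 ‵∧ ‵ 2)))
                  (⋀ (map (λ x → a ⇒ f x) xs) ∷ a ∷ ⋀ (map f xs) ∷ f x ∷ []))
       (⋀-map-⇒ a f xs)

  □-mono : ∀ A {a b} → ⊢ a ⇒ b → ⊢ □ A a ⇒ □ A b
  □-mono A {a} {b} a⇒b = mp (K-box A a b) (nec-box A a⇒b)

  □-cong : ∀ A {a b} → ⊢ a ⇔ₛ b → ⊢ □ A a ⇔ₛ □ A b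
  □-cong A a⇔b = ⇒⇐⇒⇔ (□-mono A (⇔⇒⇒ a⇔b)) (□-mono A (⇔⇒⇐ a⇔b))

  []-mono : ∀ π {a b} → ⊢ a ⇒ b → ⊢ [ π ] a ⇒ [ π ] b
  []-mono π {a} {b} a⇒b = mp (K-prog π a b) (nec-prog π a⇒b)

  []-cong : ∀ π {a b} → ⊢ a ⇔ₛ b → ⊢ [ π ] a ⇔ₛ [ π ] b
  []-cong π a⇔b = ⇒⇐⇒⇔ ([]-mono π (⇔⇒⇒ a⇔b)) ([]-mono π (⇔⇒⇐ a⇔b))

  []-∧ : ∀ π a b → ⊢ [ π ] (a ∧ₛ b) ⇔ₛ ([ π ] a ∧ₛ [ π ] b)
  []-∧ π a b = ⇒⇐⇒⇔ (⇒-∧ ([]-mono π (tautology (‵ 0 ‵∧ ‵ 1 ‵⇒ ‵ 0) (a ∷ b ∷ [])))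
                          ([]-mono π (tautology (‵ 0 ‵∧ ‵ 1 ‵⇒ ‵ 1) (a ∷ b ∷ []))))
                     (⇒-uncurry (⇒-trans ([]-mono π (tautology (‵ 0 ‵⇒ (‵ 1 ‵⇒ ‵ 0 ‵∧ ‵ 1)) (a ∷ b ∷ [])))
                                         (K-prog π b (a ∧ₛ b))))

  []-⊤ : ∀ π → ⊢ [ π ] ⊤ₛ ⇔ₛ ⊤ₛ
  []-⊤ π = mp (tautology (‵ 0 ‵⇒ (‵ 0 ‵⇔ ‵⊤)) ([ π ] ⊤ₛ ∷ [])) (nec-prog π (tautology ‵⊤ []))

  []-⋀-map : ∀ {X : Set} π (f : X → Sentence) xs → ⊢ [ π ] ⋀ (map f xs) ⇔ₛ ⋀ (map (λ x → [ π ] f x) xs)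
  []-⋀-map π f []       = []-⊤ π
  []-⋀-map π f (x ∷ xs) = ⇔-trans ([]-∧ π (f x) (⋀ (map f xs))) (∧-cong ⇔-refl ([]-⋀-map π f xs))

  [crash] : ∀ a → ⊢ [ crash ] a
  [crash] a = mp ([]-mono crash (tautology (‵¬ ‵⊤ ‵⇒ ‵ 0) (a ∷ []))) crashAx

  PartiallyFunctional : Program → Set
  PartiallyFunctional α = ∀ χ → ⊢ [ α ] ¬ₛ χ ⇔ₛ (Pre α ⇒ ¬ₛ ([ α ] χ))

  module _ {α} (pf : PartiallyFunctional α) where

    ⟨⟩⇔Pre∧[] : ∀ a → ⊢ ⟨ α ⟩ a ⇔ₛ (Pre α ∧ₛ [ α ] a)
    ⟨⟩⇔Pre∧[] a = ⇔-trans (¬-cong (pf a)) (tautology (‵¬ (‵ 0 ‵⇒ ‵¬ (‵ 1)) ‵⇔ ‵ 0 ‵∧ ‵ 1) (Pre α ∷ [ α ] a ∷ []))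

    ⟨⟩⇒Pre : ∀ a → ⊢ ⟨ α ⟩ a ⇒ Pre α
    ⟨⟩⇒Pre a = ⇒-trans (⇔⇒⇒ (⟨⟩⇔Pre∧[] a)) (tautology (‵ 0 ‵∧ ‵ 1 ‵⇒ ‵ 0) (Pre α ∷ [ α ] a ∷ []))

    []-⇒ : ∀ a b → ⊢ [ α ] (a ⇒ b) ⇔ₛ (⟨ α ⟩ a ⇒ [ α ] b)
    []-⇒ a b = begin
      [ α ] ¬ₛ (a ∧ₛ ¬ₛ b)                              ≈⟨ pf (a ∧ₛ ¬ₛ b) ⟩
      Pre α ⇒ ¬ₛ ([ α ] (a ∧ₛ ¬ₛ b))                    ≈⟨ ⇒-congʳ (¬-cong ([]-∧ α a (¬ₛ b))) ⟩
      Pre α ⇒ ¬ₛ ([ α ] a ∧ₛ [ α ] ¬ₛ b)                ≈⟨ ⇒-congʳ (¬-cong (∧-cong ⇔-refl (pf b))) ⟩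
      Pre α ⇒ ¬ₛ ([ α ] a ∧ₛ (Pre α ⇒ ¬ₛ ([ α ] b)))    ≈⟨ curry ⟩
      (Pre α ∧ₛ [ α ] a) ⇒ [ α ] b                      ≈⟨ ⇒-congˡ (⟨⟩⇔Pre∧[] a) ⟨
      ⟨ α ⟩ a ⇒ [ α ] b                                 ∎
      where
      curry : ⊢ (Pre α ⇒ ¬ₛ ([ α ] a ∧ₛ (Pre α ⇒ ¬ₛ ([ α ] b)))) ⇔ₛ ((Pre α ∧ₛ [ α ] a) ⇒ [ α ] b)
      curry = tautology ((‵ 0 ‵⇒ ‵¬ (‵ 1 ‵∧ (‵ 0 ‵⇒ ‵¬ (‵ 2)))) ‵⇔ (‵ 0 ‵∧ ‵ 1 ‵⇒ ‵ 2))
                        (Pre α ∷ [ α ] a ∷ [ α ] b ∷ [])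

  partialFunctionality : ∀ {α} → IsSimple α → PartiallyFunctional α
  partialFunctionality skip χ =
    mp (mp (tautology ((‵ 0 ‵⇔ ‵¬ (‵ 1)) ‵⇒ (‵ 2 ‵⇔ ‵ 1) ‵⇒ (‵ 0 ‵⇔ (‵⊤ ‵⇒ ‵¬ (‵ 2))))
                      ([ skip ] ¬ₛ χ ∷ χ ∷ [ skip ] χ ∷ []))
           (skipAx (¬ₛ χ)))
       (skipAx χ)
  partialFunctionality crash χ =
    mp (tautology (‵ 0 ‵⇒ (‵ 0 ‵⇔ (‵¬ ‵⊤ ‵⇒ ‵ 1))) ([ crash ] ¬ₛ χ ∷ ¬ₛ ([ crash ] χ) ∷ [])) ([crash] _)
  partialFunctionality (act i ψs) = partialFun i ψs
  partialFunctionality (seq {α} {β} α-simple β-simple) χ = begin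
    [ α ⨾ β ] ¬ₛ χ                              ≈⟨ composition α β (¬ₛ χ) ⟨
    [ α ] [ β ] ¬ₛ χ                            ≈⟨ []-cong α (partialFunctionality β-simple χ) ⟩
    [ α ] (Pre β ⇒ ¬ₛ ([ β ] χ))                ≈⟨ []-⇒ pfα (Pre β) (¬ₛ ([ β ] χ)) ⟩
    ⟨ α ⟩ Pre β ⇒ [ α ] ¬ₛ ([ β ] χ)            ≈⟨ ⇒-congʳ (pfα ([ β ] χ)) ⟩
    ⟨ α ⟩ Pre β ⇒ (Pre α ⇒ ¬ₛ ([ α ] [ β ] χ))  ≈⟨ ⇒-absorb (⟨⟩⇒Pre pfα (Pre β)) ⟩
    ⟨ α ⟩ Pre β ⇒ ¬ₛ ([ α ] [ β ] χ)            ≈⟨ ⇒-congʳ (¬-cong (composition α β χ)) ⟩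
    ⟨ α ⟩ Pre β ⇒ ¬ₛ ([ α ⨾ β ] χ)              ∎
    where
    pfα : PartiallyFunctional α
    pfα = partialFunctionality α-simple

  successors : Agents → Program → List Program
  successors A skip       = skip ∷ []
  successors A crash      = []
  successors A (act i ψs) = map (λ j → act j ψs) (filterᵇ (arrow A i) (allFin n))
  successors A (α ∪ β)    = []
  successors A (α ⨾ β)    = cartesianProductWith _⨾_ (successors A α) (successors A β)

  successors⇒⟶ : ∀ {A} α {β} → β ∈ successors A α → α ⟶[ A ] β
  successors⇒⟶ skip (here refl) = skip→
  successors⇒⟶ {A} (act i ψs) β∈
    with _ , _ , refl , i→j ← ∈-map∘filter⁻ (λ j → act j ψs) (T? ∘ arrow A i) {xs = allFin n} β∈
    = act→ i→j
  successors⇒⟶ {A} (α ⨾ β) αβ∈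
    with _ , _ , α∈ , β∈ , refl ← ∈-cartesianProductWith⁻ _⨾_ (successors A α) (successors A β) αβ∈
    = seq→ (successors⇒⟶ α α∈) (successors⇒⟶ β β∈)

  ⟶⇒successors : ∀ {A α β} → α ⟶[ A ] β → β ∈ successors A α
  ⟶⇒successors skip→ = here refl
  ⟶⇒successors {A} {act i ψs} (act→ {j = j} i→j) =
    ∈-map∘filter⁺ (λ j → act j ψs) (T? ∘ arrow A i) (j , ∈-allFin j , refl , i→j)
  ⟶⇒successors (seq→ α⟶ β⟶) = ∈-cartesianProductWith⁺ _⨾_ (⟶⇒successors α⟶) (⟶⇒successors β⟶)

  knowsAfterEach : Agents → Sentence → List Program → Sentence
  knowsAfterEach A φ βs = ⋀ (map (λ β → □ A ([ β ] φ)) βs)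

  knowsAfterEach-⨾ : ∀ A φ αs βs →
    ⊢ ⋀ (map (λ β → knowsAfterEach A ([ β ] φ) αs) βs) ⇔ₛ knowsAfterEach A φ (cartesianProductWith _⨾_ αs βs)
  knowsAfterEach-⨾ A φ αs βs =
    ⇒⇐⇒⇔ (⋀-map-intro _ _ nested⇒pair)
         (⋀-map-intro _ βs λ β∈ → ⋀-map-intro _ αs (pair⇒nested β∈))
    where
    nested : Sentence
    nested = ⋀ (map (λ β → knowsAfterEach A ([ β ] φ) αs) βs)

    nested⇒pair : ∀ {γ} → γ ∈ cartesianProductWith _⨾_ αs βs → ⊢ nested ⇒ □ A ([ γ ] φ)
    nested⇒pair γ∈ with α , β , α∈ , β∈ , refl ← ∈-cartesianProductWith⁻ _⨾_ αs βs γ∈ =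
      ⇒-trans (⋀-map-elim _ β∈) (⇒-trans (⋀-map-elim _ α∈) (□-mono A (⇔⇒⇒ (composition α β φ))))

    pair⇒nested : ∀ {α β} → β ∈ βs → α ∈ αs →
                  ⊢ knowsAfterEach A φ (cartesianProductWith _⨾_ αs βs) ⇒ □ A ([ α ] [ β ] φ)
    pair⇒nested β∈ α∈ =
      ⇒-trans (⋀-map-elim _ (∈-cartesianProductWith⁺ _⨾_ α∈ β∈)) (□-mono A (⇔⇒⇐ (composition _ _ φ)))

  actionKnowledge : ∀ {α} → IsSimple α → ∀ A φ → ⊢ [ α ] □ A φ ⇔ₛ (Pre α ⇒ knowsAfterEach A φ (successors A α))
  actionKnowledge skip A φ = begin
    [ skip ] □ A φ    ≈⟨ skipAx (□ A φ) ⟩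
    □ A φ             ≈⟨ □-cong A (skipAx φ) ⟨
    □ A ([ skip ] φ)  ≈⟨ tautology (‵ 0 ‵⇔ (‵⊤ ‵⇒ ‵ 0 ‵∧ ‵⊤)) (□ A ([ skip ] φ) ∷ []) ⟩
    ⊤ₛ ⇒ (□ A ([ skip ] φ) ∧ₛ ⊤ₛ) ∎
  actionKnowledge crash A φ = mp (tautology (‵ 0 ‵⇒ (‵ 0 ‵⇔ (‵¬ ‵⊤ ‵⇒ ‵⊤))) ([ crash ] □ A φ ∷ [])) ([crash] _)
  actionKnowledge (act i ψs) A φ =
    subst (λ conj → ⊢ [ act i ψs ] □ A φ ⇔ₛ (lookup ψs i ⇒ ⋀ conj))
          (map-∘ (filterᵇ (arrow A i) (allFin n)))
          (actionKnow i ψs A φ)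
  actionKnowledge (seq {α} {β} α-simple β-simple) A φ = begin
    [ α ⨾ β ] □ A φ                                 ≈⟨ composition α β (□ A φ) ⟨
    [ α ] [ β ] □ A φ                               ≈⟨ []-cong α (actionKnowledge β-simple A φ) ⟩
    [ α ] (Pre β ⇒ knowsAfterEach A φ βs)           ≈⟨ []-⇒ pfα (Pre β) _ ⟩
    ⟨ α ⟩ Pre β ⇒ [ α ] knowsAfterEach A φ βs       ≈⟨ ⇒-congʳ ([]-⋀-map α _ βs) ⟩
    ⟨ α ⟩ Pre β ⇒ ⋀ (map (λ β' → [ α ] □ A ([ β' ] φ)) βs)
        ≈⟨ ⇒-congʳ (⋀-map-cong (λ β' → actionKnowledge α-simple A ([ β' ] φ)) βs) ⟩
    ⟨ α ⟩ Pre β ⇒ ⋀ (map (λ β' → Pre α ⇒ knowsAfterEach A ([ β' ] φ) αs) βs)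
        ≈⟨ ⇒-congʳ (⋀-map-⇒ (Pre α) _ βs) ⟩
    ⟨ α ⟩ Pre β ⇒ (Pre α ⇒ ⋀ (map (λ β' → knowsAfterEach A ([ β' ] φ) αs) βs))
        ≈⟨ ⇒-absorb (⟨⟩⇒Pre pfα (Pre β)) ⟩
    ⟨ α ⟩ Pre β ⇒ ⋀ (map (λ β' → knowsAfterEach A ([ β' ] φ) αs) βs)
        ≈⟨ ⇒-congʳ (knowsAfterEach-⨾ A φ αs βs) ⟩
    ⟨ α ⟩ Pre β ⇒ knowsAfterEach A φ (successors A (α ⨾ β)) ∎
    where
    αs βs : List Program
    αs = successors A α
    βs = successors A β

    pfα : PartiallyFunctional α
    pfα = partialFunctionality α-simple

mainTheorem10 : (AtSen Agents : Set) (Sig : Signature Agents) →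
    let open L1 AtSen Agents Sig in
    (α : Program) → IsSimple α → (A : Agents) (φ : Sentence) →
    (βs : List Program) → (∀ β → (β ∈ βs) ⇔ (α ⟶[ A ] β)) →
    ⊢ [ α ] □ A φ ⇔ₛ (Pre α ⇒ ⋀ (map (λ β → □ A ([ β ] φ)) βs))
mainTheorem10 AtSen Agents Sig α α-simple A φ βs enumerates =
  ⇔-trans (actionKnowledge α-simple A φ)
          (⇒-congʳ (⇒⇐⇒⇔ (⋀-map-antitone _ βs⊆successors) (⋀-map-antitone _ successors⊆βs)))
  where
  open Derivations AtSen Agents Sig

  βs⊆successors : βs ⊆ successors A α
  βs⊆successors {β} = ⟶⇒successors ∘ Equivalence.to (enumerates β)

  successors⊆βs : successors A α ⊆ βs
  successors⊆βs {β} = Equivalence.from (enumerates β) ∘ successors⇒⟶ α
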